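{- Let $f_1 f_2 \cdots f_z$ be the LZ-End parsing of a string $s$. Let $i$ be the maximal integer such that the string $f_{z-i} f_{z-i+1} \cdots f_z$ is a suffix of a string $f_1 f_2 \cdots f_j$ for some $j < z-i$. Then, for any letter $a$, the LZ-End parsing of the string $sa$ is $f'_1 f'_2 \cdots f'_{z'}$, where $z' = z - i$, $f'_1 = f_1, f'_2 = f_2, \ldots, f'_{z'-1} = f_{z'-1}$, and $f'_{z'} = f_{z-i} f_{z-i+1}\cdots f_z a$.
   Context: For a string $s$, $s[i..j] = s[i]s[i+1]\cdots s[j]$. The LZ-End parsing of $s$ is the decomposition $s = f_1 f_2 \cdots f_z$ built greedily from left to right: if a prefix $s[1..k] = f_1 f_2\cdots f_{i-1}$ has already been parsed, then $f_i[1..|f_i|-1]$ is the longest prefix of $s[k+1..|s|-1]$ that is a suffix of some string $f_1 f_2 \cdots f_j$ with $j < i$ (the empty string counts as such a suffix), and $f_i$ is this prefix extended by the next letter of $s$. The substrings $f_i$ are called phrases. In the claim, $i$ ranges over integers $-1 \le i < z$, where for $i=-1$ the concatenation $f_{z+1}\cdots f_z$ is the empty string (so that $i$ always exists). -}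

module Defs where

open import Data.Nat using (ℕ; _≤_; _<_)
open import Data.List using (List; []; _∷_; _++_; [_]; length; concat; take; drop)
open import Data.Product using (Σ; _×_; ∃; ∃-syntax)
open import Relation.Binary.PropositionalEquality using (_≡_)

Prefix : {A : Set} → List A → List A → Set
Prefix {A} u v = ∃[ t ] (u ++ t ≡ v)

Suffix : {A : Set} → List A → List A → Set
Suffix {A} u v = ∃[ t ] (t ++ u ≡ v)

-- w is a suffix of f_1 ⋯ f_j for some j < i, where P = f_1 ⋯ f_{i-1}
-- (j = 0 gives the empty concatenation, so the empty string always counts)
EndsAtPhrase : {A : Set} → List (List A) → List A → Set
EndsAtPhrase P w = ∃[ j ] (j ≤ length P × Suffix w (concat (take j P)))

-- f is the greedy LZ-End phrase following the already parsed phrases P,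
-- where r is the (nonempty) unparsed remainder of s:
-- f = w c, with w the longest prefix of r[1..|r|-1] that ends at a phrase boundary.
ValidPhrase : {A : Set} → List (List A) → List A → List A → Set
ValidPhrase {A} P r f =
  ∃[ w ] ∃[ c ] (f ≡ w ++ [ c ] × Prefix f r × EndsAtPhrase P w ×
    ((w' : List A) → Prefix w' r → length w' < length r →
       EndsAtPhrase P w' → length w' ≤ length w))

data LZEndFrom {A : Set} : List (List A) → List A → List (List A) → Set where
  done : ∀ {P} → LZEndFrom P [] []
  step : ∀ {P r f r' fs} → ValidPhrase P r f → r ≡ f ++ r' →
         LZEndFrom (P ++ [ f ]) r' fs → LZEndFrom P r (f ∷ fs)

IsLZEnd : {A : Set} → List A → List (List A) → Set
IsLZEnd s fs = LZEndFrom [] s fs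

-- With k = z - i - 1 (0-based start index of the tail f_{z-i} ⋯ f_z):
-- f_{k+1} ⋯ f_z is a suffix of f_1 ⋯ f_j for some j < k+1 = z - i.
TailCond : {A : Set} → List (List A) → ℕ → Set
TailCond fs k = ∃[ j ] (j ≤ k × Suffix (concat (drop k fs)) (concat (take j fs)))

module Submission where

-- Only the last phrase can change when a letter is appended: an earlier phrase f_i, chosen
-- from the remainder r of s, could only grow if the whole of r ended at a phrase boundary
-- before f_i, and then the tail starting at f_i would already satisfy the tail condition.
-- Hence, by minimality of k, the phrases f_1 ⋯ f_k stay greedy in sa, and the remainder
-- f_{k+1} ⋯ f_z a is a single phrase because f_{k+1} ⋯ f_z ends at a phrase boundary.

open import Defs
open import Data.Nat using (ℕ; zero; suc; pred; _≤_; _<_; z≤n; s≤s)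
open import Data.Nat.Properties
  using (≤-trans; <-≤-trans; <⇒≤; <⇒≱; m≤m+n; m≤n⇒m<n∨m≡n; m≤n⇒m⊓n≡m; m⊓n≤m)
open import Data.List using (List; []; _∷_; _++_; [_]; length; concat; take; drop)
open import Data.List.Properties using (++-assoc; ++-identityʳ; ∷-injective; length-++; length-take; take-take)
open import Data.Product using (_,_)
open import Data.Sum using (inj₁; inj₂)
open import Function using (id; _∘′_)
open import Relation.Nullary using (¬_; contradiction)
open import Relation.Binary.PropositionalEquality using (_≡_; refl; sym; trans; cong; subst; subst₂)

private
  variable
    A : Set
    P fs : List (List A)

prefix-length : {w r : List A} → Prefix w r → length w ≤ length r
prefix-length {w = w} (t , refl) = subst (length w ≤_) (sym (length-++ w)) (m≤m+n _ _)

prefix-++ʳ : {w r : List A} (u : List A) → Prefix w r → Prefix w (r ++ u)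
prefix-++ʳ {w = w} u (t , refl) = t ++ u , sym (++-assoc w t u)

prefix-∷ʳ-shorter : (w r : List A) (a : A) →
                    Prefix w (r ++ [ a ]) → length w < length (r ++ [ a ]) → Prefix w r
prefix-∷ʳ-shorter []      r       a _       _           = r , refl
prefix-∷ʳ-shorter (x ∷ w) []      a _       (s≤s ())
prefix-∷ʳ-shorter (x ∷ w) (y ∷ r) a (t , eq) (s≤s short) with refl , eq′ ← ∷-injective eq
  with u , w++u≡r ← prefix-∷ʳ-shorter w r a (t , eq′) short = u , cong (x ∷_) w++u≡r

prefix-of-equal-length : (w r : List A) → Prefix w r → length w ≡ length r → w ≡ r
prefix-of-equal-length []      []      _        _   = refl
prefix-of-equal-length (x ∷ w) (y ∷ r) (t , eq) len with refl , eq′ ← ∷-injective eq =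
  cong (x ∷_) (prefix-of-equal-length w r (t , eq′) (cong pred len))

lzEndFrom-concat : {r : List A} → LZEndFrom P r fs → r ≡ concat fs
lzEndFrom-concat done                        = refl
lzEndFrom-concat (step {f = f} _ refl rest) = cong (f ++_) (lzEndFrom-concat rest)

validPhrase-∷ʳ : {r f : List A} → ValidPhrase P r f → ¬ EndsAtPhrase P r →
                 (a : A) → ValidPhrase P (r ++ [ a ]) f
validPhrase-∷ʳ {P = P} {r = r} {f} (w , c , f≡wc , f⊑r , w↲ , longest) r↲̸ a =
  w , c , f≡wc , prefix-++ʳ [ a ] f⊑r , w↲ , longest′
  where
  longest′ : (w′ : List _) → Prefix w′ (r ++ [ a ]) → length w′ < length (r ++ [ a ]) →
             EndsAtPhrase P w′ → length w′ ≤ length w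
  longest′ w′ w′⊑ra short w′↲ with w′⊑r ← prefix-∷ʳ-shorter w′ r a w′⊑ra short
    with m≤n⇒m<n∨m≡n (prefix-length w′⊑r)
  ... | inj₁ shorter = longest w′ w′⊑r shorter w′↲
  ... | inj₂ same    =
    contradiction (subst (EndsAtPhrase P) (prefix-of-equal-length w′ r w′⊑r same) w′↲) r↲̸

lzEndFrom-single : (r : List A) (a : A) → EndsAtPhrase P r → LZEndFrom P (r ++ [ a ]) [ r ++ [ a ] ]
lzEndFrom-single r a r↲ =
  step (r , a , refl , ([] , ++-identityʳ _) , r↲ ,
        λ w′ w′⊑ra short _ → prefix-length (prefix-∷ʳ-shorter w′ r a w′⊑ra short))
       (sym (++-identityʳ _)) done

TailEndsAtPhrase : List (List A) → List (List A) → ℕ → Set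
TailEndsAtPhrase P fs k = EndsAtPhrase (P ++ take k fs) (concat (drop k fs))

tailEndsAtPhrase-∷ : (P : List (List A)) (f : List A) (fs : List (List A)) (k : ℕ) →
                     TailEndsAtPhrase P (f ∷ fs) (suc k) ≡ TailEndsAtPhrase (P ++ [ f ]) fs k
tailEndsAtPhrase-∷ P f fs k =
  cong (λ Q → EndsAtPhrase Q (concat (drop k fs))) (sym (++-assoc P [ f ] (take k fs)))

lzEndFrom-∷ʳ : {r : List A} → LZEndFrom P r fs → (k : ℕ) → k ≤ length fs →
               TailEndsAtPhrase P fs k → ((m : ℕ) → m < k → ¬ TailEndsAtPhrase P fs m) →
               (a : A) → LZEndFrom P (r ++ [ a ]) (take k fs ++ [ concat (drop k fs) ++ [ a ] ])
lzEndFrom-∷ʳ {P = P} {fs = fs} parse zero _ tail↲ _ a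
  rewrite lzEndFrom-concat parse =
    lzEndFrom-single (concat fs) a (subst (λ Q → EndsAtPhrase Q _) (++-identityʳ P) tail↲)
lzEndFrom-∷ʳ {P = P} parse@(step {f = f} {r' = r′} {fs = fs} valid refl rest)
             (suc k) (s≤s k≤) tail↲ earlier a =
  step (validPhrase-∷ʳ valid r↲̸ a) (++-assoc f r′ [ a ])
       (lzEndFrom-∷ʳ rest k k≤ (subst id (tailEndsAtPhrase-∷ P f fs k) tail↲)
          (λ m m<k → earlier (suc m) (s≤s m<k) ∘′ subst id (sym (tailEndsAtPhrase-∷ P f fs m))) a)
  where
  r↲̸ : ¬ EndsAtPhrase P (f ++ r′)
  r↲̸ r↲ = earlier zero (s≤s z≤n)
    (subst₂ EndsAtPhrase (sym (++-identityʳ P)) (lzEndFrom-concat parse) r↲)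

take-take-≤ : {j m : ℕ} (xs : List A) → j ≤ m → take j (take m xs) ≡ take j xs
take-take-≤ {j = j} {m} xs j≤m = trans (take-take j m xs) (cong (λ n → take n xs) (m≤n⇒m⊓n≡m j≤m))

tailCond⇒tailEndsAtPhrase : {m : ℕ} → m ≤ length fs → TailCond fs m → TailEndsAtPhrase [] fs m
tailCond⇒tailEndsAtPhrase {fs = fs} {m} m≤ (j , j≤m , suffix) =
  j , subst (j ≤_) (sym (trans (length-take m fs) (m≤n⇒m⊓n≡m m≤))) j≤m ,
  subst (Suffix (concat (drop m fs)) ∘′ concat) (sym (take-take-≤ fs j≤m)) suffix

tailEndsAtPhrase⇒tailCond : {m : ℕ} → TailEndsAtPhrase [] fs m → TailCond fs m
tailEndsAtPhrase⇒tailCond {fs = fs} {m} (j , j≤ , suffix) =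
  j , j≤m , subst (Suffix (concat (drop m fs)) ∘′ concat) (take-take-≤ fs j≤m) suffix
  where
  j≤m : j ≤ m
  j≤m = ≤-trans j≤ (subst (_≤ m) (sym (length-take m fs)) (m⊓n≤m m _))

lemma2 : {A : Set} (s : List A) (fs : List (List A)) → IsLZEnd s fs →
         (k : ℕ) → k ≤ length fs → TailCond fs k →
         ((k' : ℕ) → k' ≤ length fs → TailCond fs k' → k ≤ k') →
         (a : A) → IsLZEnd (s ++ [ a ]) (take k fs ++ [ concat (drop k fs) ++ [ a ] ])
lemma2 s fs parse k k≤ tail minimal a =
  lzEndFrom-∷ʳ parse k k≤ (tailCond⇒tailEndsAtPhrase k≤ tail) earlier a
  where
  earlier : (m : ℕ) → m < k → ¬ TailEndsAtPhrase [] fs m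
  earlier m m<k tail′ =
    <⇒≱ m<k (minimal m (<⇒≤ (<-≤-trans m<k k≤)) (tailEndsAtPhrase⇒tailCond tail′))
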